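{- Let $d$ be a positive integer, let $S,T\subseteq\mathbb{N}^d$ be generalized numerical semigroups and let $f:S\rightarrow T$ be a monoid isomorphism. Then $\operatorname{g}(S)=\operatorname{g}(T)$.
   Context: A generalized numerical semigroup (GNS) in $\mathbb{N}^d$ is a submonoid $S$ of $(\mathbb{N}^d,+)$ with $\operatorname{H}(S)=\mathbb{N}^d\setminus S$ finite; its genus is $\operatorname{g}(S)=|\operatorname{H}(S)|$. A monoid isomorphism is a bijective additive map. -}

module Defs where

open import Data.Nat using (ℕ; suc)
open import Data.Bool using (Bool; true)
open import Data.Vec using (Vec; replicate; zipWith)
open import Data.List using (List; length)
open import Data.List.Membership.Propositional using (_∈_)
open import Data.List.Relation.Unary.Unique.Propositional using (Unique)
open import Data.Product using (Σ; _×_; ∃; _,_; proj₁)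
open import Function.Bundles using (_⇔_)
open import Function.Definitions using (Bijective)
open import Relation.Binary.PropositionalEquality using (_≡_)
open import Relation.Nullary using (¬_)

ℕ^ : ℕ → Set
ℕ^ d = Vec ℕ d

_⊕_ : ∀ {d} → ℕ^ d → ℕ^ d → ℕ^ d
_⊕_ = zipWith Data.Nat._+_

𝟎 : ∀ {d} → ℕ^ d
𝟎 = replicate _ 0

-- A subset of ℕ^d, given by its (Boolean) characteristic function,
-- so that membership is proof-irrelevant.
Subset : ℕ → Set
Subset d = ℕ^ d → Bool

_∈S_ : ∀ {d} → ℕ^ d → Subset d → Set
x ∈S S = S x ≡ true

IsHoleList : ∀ {d} → Subset d → List (ℕ^ d) → Set
IsHoleList S H = Unique H × (∀ x → (x ∈ H) ⇔ (¬ (x ∈S S)))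

record IsGNS {d : ℕ} (S : Subset d) : Set where
  field
    zero∈  : 𝟎 ∈S S
    +-closed : ∀ x y → x ∈S S → y ∈S S → (x ⊕ y) ∈S S
    finiteHoles : ∃ λ (H : List (ℕ^ d)) → IsHoleList S H

HasGenus : ∀ {d} → Subset d → ℕ → Set
HasGenus S n = ∃ λ H → IsHoleList S H × length H ≡ n

Elem : ∀ {d} → Subset d → Set
Elem {d} S = Σ (ℕ^ d) (λ x → x ∈S S)

record IsMonoidIso {d : ℕ} (S T : Subset d) (f : Elem S → Elem T) : Set where
  field
    additive : ∀ (a b : Elem S) (ab : (proj₁ a ⊕ proj₁ b) ∈S S) →
               proj₁ (f ((proj₁ a ⊕ proj₁ b) , ab)) ≡ (proj₁ (f a) ⊕ proj₁ (f b))
    bijective : Bijective _≡_ _≡_ f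

{-# OPTIONS --safe #-}
module Submission where

-- Since S has finitely many holes, some translate a + ℕ^d of the orthant lies in
-- S; put f⁺(x) = f(a + x) for every x ∈ ℕ^d.  Additivity of f gives
-- f⁺(x + y) + f⁺(0) = f⁺(x) + f⁺(y), so every coordinate of k ↦ f⁺(k·x) is an
-- arithmetic progression in ℕ, hence f⁺(0) ≤ f⁺(x).  Then φ(x) = f⁺(x) − f⁺(0) is
-- an injective map ℕ^d → ℕ^d extending f, and surjectivity of f forces φ to send
-- holes of S to holes of T.  So g(S) ≤ g(T), and g(T) ≤ g(S) by the same argument
-- applied to f⁻¹.

open import Defs
open import Algebra.Bundles using (CommutativeSemigroup)
import Algebra.Properties.CommutativeSemigroup as CommutativeSemigroupProperties
open import Axiom.UniquenessOfIdentityProofs using (module Decidable⇒UIP)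
open import Data.Bool using (true)
open import Data.Bool.Properties using () renaming (_≟_ to _≟ᵇ_)
open import Data.Fin using (Fin; zero; suc)
open import Data.Fin.Properties using (injective⇒≤)
open import Data.List using (List; _∷_; length; map; lookup)
open import Data.List.Extrema.Nat using (max; xs≤max)
open import Data.List.Membership.Propositional using (_∈_)
open import Data.List.Membership.Propositional.Properties using (∈-lookup; ∈-map⁺)
import Data.List.Relation.Unary.All as All
open import Data.List.Relation.Unary.AllPairs using (_∷_)
open import Data.List.Relation.Unary.Any using (index)
open import Data.List.Relation.Unary.Any.Properties using (lookup-index)
open import Data.List.Relation.Unary.Unique.Propositional using (Unique)
open import Data.Nat using (ℕ; zero; suc; _+_; _∸_; _≤_; _<_; s≤s)
open import Data.Nat.Properties
open import Data.Product using (∃; _,_; proj₁; proj₂)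
open import Data.Vec using ([]; _∷_; zipWith; head)
import Data.Vec as Vec
import Data.Vec.Properties as Vec
open import Function using (_∘_)
open import Function.Bundles using (Equivalence)
import Function.Construct.Symmetry as Symmetry
open import Function.Definitions using (Injective)
open import Relation.Binary.PropositionalEquality
open import Relation.Binary.PropositionalEquality.Algebra using (isMagma)
open import Relation.Nullary using (¬_; contradiction)
open import Relation.Nullary.Decidable using (decidable-stable)

Unique⇒lookup-injective : ∀ {A : Set} {xs : List A} → Unique xs → Injective _≡_ _≡_ (lookup xs)
Unique⇒lookup-injective (_ ∷ _) {zero} {zero} _ = refl
Unique⇒lookup-injective (x∉xs ∷ _) {zero} {suc j} x≡xⱼ =
  contradiction x≡xⱼ (All.lookup x∉xs (∈-lookup j))
Unique⇒lookup-injective (x∉xs ∷ _) {suc i} {zero} xᵢ≡x =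
  contradiction (sym xᵢ≡x) (All.lookup x∉xs (∈-lookup i))
Unique⇒lookup-injective (_ ∷ xs-unique) {suc i} {suc j} xᵢ≡xⱼ =
  cong suc (Unique⇒lookup-injective xs-unique xᵢ≡xⱼ)

injection⇒length≤ : ∀ {A B : Set} {xs : List A} {ys : List B} (φ : A → B) →
                    Injective _≡_ _≡_ φ → Unique xs → (∀ {x} → x ∈ xs → φ x ∈ ys) →
                    length xs ≤ length ys
injection⇒length≤ {xs = xs} {ys} φ φ-injective xs-unique φ[xs]⊆ys = injective⇒≤ position-injective
  where
  position : Fin (length xs) → Fin (length ys)
  position i = index (φ[xs]⊆ys (∈-lookup i))

  position-injective : Injective _≡_ _≡_ position
  position-injective {i} {j} eq = Unique⇒lookup-injective xs-unique (φ-injective (begin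
    φ (lookup xs i)         ≡⟨ lookup-index (φ[xs]⊆ys (∈-lookup i)) ⟩
    lookup ys (position i)  ≡⟨ cong (lookup ys) eq ⟩
    lookup ys (position j)  ≡⟨ lookup-index (φ[xs]⊆ys (∈-lookup j)) ⟨
    φ (lookup xs j)         ∎))
    where open ≡-Reasoning

arithmetic-progression-nondecreasing : ∀ (u : ℕ → ℕ) b →
                                       (∀ k → u (suc k) + u 0 ≡ u k + b) → u 0 ≤ b
arithmetic-progression-nondecreasing u b progression =
  ≮⇒≥ λ b<u₀ → 1+n≰n (≤-trans (m≤n+m (suc (u 0)) _) (descends b<u₀ (suc (u 0))))
  where
  open ≤-Reasoning

  descends : b < u 0 → ∀ k → u k + k ≤ u 0
  descends _ zero = ≤-reflexive (+-identityʳ (u 0))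
  descends b<u₀ (suc k) = begin
    u (suc k) + suc k  ≡⟨ +-suc (u (suc k)) k ⟩
    suc (u (suc k) + k) ≤⟨ +-monoˡ-≤ k decreasing ⟩
    u k + k            ≤⟨ descends b<u₀ k ⟩
    u 0                ∎
    where
    decreasing : u (suc k) < u k
    decreasing = +-cancelʳ-< (u 0) (u (suc k)) (u k)
      (subst (_< u k + u 0) (sym (progression k)) (+-monoʳ-< (u k) b<u₀))

⊕-progression-nondecreasing : ∀ {d} (v : ℕ → ℕ^ d) b → (∀ k → v (suc k) ⊕ v 0 ≡ v k ⊕ b) →
                              ∀ j → Vec.lookup (v 0) j ≤ Vec.lookup b j
⊕-progression-nondecreasing v b progression j =
  arithmetic-progression-nondecreasing (λ k → Vec.lookup (v k) j) (Vec.lookup b j) λ k → begin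
    Vec.lookup (v (suc k)) j + Vec.lookup (v 0) j  ≡⟨ Vec.lookup-zipWith _+_ j (v (suc k)) (v 0) ⟨
    Vec.lookup (v (suc k) ⊕ v 0) j                 ≡⟨ cong (λ w → Vec.lookup w j) (progression k) ⟩
    Vec.lookup (v k ⊕ b) j                         ≡⟨ Vec.lookup-zipWith _+_ j (v k) b ⟩
    Vec.lookup (v k) j + Vec.lookup b j            ∎
  where open ≡-Reasoning

⊕-commutativeSemigroup : ℕ → CommutativeSemigroup _ _
⊕-commutativeSemigroup d = record
  { Carrier = ℕ^ d
  ; _∙_ = _⊕_
  ; isCommutativeSemigroup = record
    { isSemigroup = record { isMagma = isMagma _⊕_ ; assoc = Vec.zipWith-assoc +-assoc }
    ; comm = Vec.zipWith-comm +-comm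
    }
  }

⊕-identityʳ : ∀ {d} (x : ℕ^ d) → x ⊕ 𝟎 ≡ x
⊕-identityʳ = Vec.zipWith-identityʳ +-identityʳ

⊕-cancelˡ : ∀ {d} (a x y : ℕ^ d) → a ⊕ x ≡ a ⊕ y → x ≡ y
⊕-cancelˡ [] [] [] _ = refl
⊕-cancelˡ (a ∷ as) (x ∷ xs) (y ∷ ys) eq =
  cong₂ _∷_ (+-cancelˡ-≡ a x y (Vec.∷-injectiveˡ eq)) (⊕-cancelˡ as xs ys (Vec.∷-injectiveʳ eq))

a⊕[b∸a]≡b : ∀ {d} (a b : ℕ^ d) → (∀ j → Vec.lookup a j ≤ Vec.lookup b j) → a ⊕ zipWith _∸_ b a ≡ b
a⊕[b∸a]≡b [] [] _ = refl
a⊕[b∸a]≡b (a ∷ as) (b ∷ bs) a≤b = cong₂ _∷_ (m+[n∸m]≡n (a≤b zero)) (a⊕[b∸a]≡b as bs (a≤b ∘ suc))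

infix 25 _·_
_·_ : ∀ {d} → ℕ → ℕ^ d → ℕ^ d
zero  · x = 𝟎
suc k · x = k · x ⊕ x

Elem-≡ : ∀ {d} {S : Subset d} {x y : ℕ^ d} {p : x ∈S S} {q : y ∈S S} →
         x ≡ y → _≡_ {A = Elem S} (x , p) (y , q)
Elem-≡ {p = p} {q} refl = cong (_ ,_) (Decidable⇒UIP.≡-irrelevant _≟ᵇ_ p q)

AddClosed : ∀ {d} → Subset d → Set
AddClosed S = ∀ x y → x ∈S S → y ∈S S → (x ⊕ y) ∈S S

inverse-isMonoidIso : ∀ {d} {S T : Subset d} {f : Elem S → Elem T} →
                      AddClosed S → IsMonoidIso S T f → ∃ (IsMonoidIso T S)
inverse-isMonoidIso {S = S} {T} {f} S-closed iso = f⁻¹ , record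
  { additive = f⁻¹-additive
  ; bijective = Symmetry.bijective bijective refl sym trans (cong f)
  }
  where
  open IsMonoidIso iso

  f⁻¹ : Elem T → Elem S
  f⁻¹ t = proj₁ (proj₂ bijective t)

  f∘f⁻¹ : ∀ t → f (f⁻¹ t) ≡ t
  f∘f⁻¹ t = proj₂ (proj₂ bijective t) refl

  f⁻¹-additive : ∀ (a b : Elem T) (ab : (proj₁ a ⊕ proj₁ b) ∈S T) →
                 proj₁ (f⁻¹ ((proj₁ a ⊕ proj₁ b) , ab)) ≡ proj₁ (f⁻¹ a) ⊕ proj₁ (f⁻¹ b)
  f⁻¹-additive a b ab = cong proj₁ (proj₁ bijective (begin
    f (f⁻¹ (proj₁ a ⊕ proj₁ b , ab))  ≡⟨ f∘f⁻¹ _ ⟩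
    (proj₁ a ⊕ proj₁ b , ab)          ≡⟨ Elem-≡ (sym f[a′⊕b′]≡a⊕b) ⟩
    f (a′ ⊕ b′ , a′⊕b′∈S)             ∎))
    where
    open ≡-Reasoning
    a′ = proj₁ (f⁻¹ a)
    b′ = proj₁ (f⁻¹ b)
    a′⊕b′∈S = S-closed a′ b′ (proj₂ (f⁻¹ a)) (proj₂ (f⁻¹ b))

    f[a′⊕b′]≡a⊕b : proj₁ (f (a′ ⊕ b′ , a′⊕b′∈S)) ≡ proj₁ a ⊕ proj₁ b
    f[a′⊕b′]≡a⊕b = trans (additive (f⁻¹ a) (f⁻¹ b) a′⊕b′∈S)
                         (cong₂ _⊕_ (cong proj₁ (f∘f⁻¹ a)) (cong proj₁ (f∘f⁻¹ b)))

OrthantIn : ∀ {d} → Subset d → ℕ^ d → Set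
OrthantIn S a = ∀ x → (a ⊕ x) ∈S S

holeList⇒orthant : ∀ {d} {S : Subset (suc d)} {H} → IsHoleList S H → ∃ (OrthantIn S)
holeList⇒orthant {S = S} {H} (_ , holes) = suc bound ∷ 𝟎 , orthant
  where
  bound = max 0 (map head H)

  orthant : OrthantIn S (suc bound ∷ 𝟎)
  orthant (x₀ ∷ x) = decidable-stable (S _ ≟ᵇ true) λ ∉S →
    1+n≰n (≤-trans (s≤s (m≤m+n bound x₀))
                   (All.lookup (xs≤max 0 (map head H)) (∈-map⁺ head (Equivalence.from (holes _) ∉S))))

module OrthantExtension {d} {S T : Subset d} (S-closed : AddClosed S)
                        {f : Elem S → Elem T} (iso : IsMonoidIso S T f)
                        {a : ℕ^ d} (a+ℕ^d⊆S : OrthantIn S a) where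

  open IsMonoidIso iso
  open CommutativeSemigroupProperties (⊕-commutativeSemigroup d) using (interchange)
  open ≡-Reasoning

  f′ : ∀ x → x ∈S S → ℕ^ d
  f′ x p = proj₁ (f (x , p))

  f′-cong : ∀ {x y p q} → x ≡ y → f′ x p ≡ f′ y q
  f′-cong x≡y = cong (proj₁ ∘ f) (Elem-≡ x≡y)

  f′-injective : ∀ {x y p q} → f′ x p ≡ f′ y q → x ≡ y
  f′-injective eq = cong proj₁ (proj₁ bijective (Elem-≡ eq))

  f′-additive : ∀ {x y} (p : x ∈S S) (q : y ∈S S) → f′ (x ⊕ y) (S-closed x y p q) ≡ f′ x p ⊕ f′ y q
  f′-additive p q = additive (_ , p) (_ , q) _

  f⁺ : ℕ^ d → ℕ^ d
  f⁺ x = f′ (a ⊕ x) (a+ℕ^d⊆S x)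

  f⁺-affine : ∀ x y → f⁺ (x ⊕ y) ⊕ f⁺ 𝟎 ≡ f⁺ x ⊕ f⁺ y
  f⁺-affine x y = begin
    f⁺ (x ⊕ y) ⊕ f⁺ 𝟎                ≡⟨ f′-additive _ _ ⟨
    f′ ((a ⊕ (x ⊕ y)) ⊕ (a ⊕ 𝟎)) _  ≡⟨ f′-cong rearrange ⟩
    f′ ((a ⊕ x) ⊕ (a ⊕ y)) _        ≡⟨ f′-additive _ _ ⟩
    f⁺ x ⊕ f⁺ y                      ∎
    where
    rearrange : (a ⊕ (x ⊕ y)) ⊕ (a ⊕ 𝟎) ≡ (a ⊕ x) ⊕ (a ⊕ y)
    rearrange = begin
      (a ⊕ (x ⊕ y)) ⊕ (a ⊕ 𝟎)  ≡⟨ interchange a (x ⊕ y) a 𝟎 ⟩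
      (a ⊕ a) ⊕ ((x ⊕ y) ⊕ 𝟎)  ≡⟨ cong ((a ⊕ a) ⊕_) (⊕-identityʳ (x ⊕ y)) ⟩
      (a ⊕ a) ⊕ (x ⊕ y)        ≡⟨ interchange a x a y ⟨
      (a ⊕ x) ⊕ (a ⊕ y)        ∎

  f⁺-on-S : ∀ {s} (p : s ∈S S) → f⁺ s ≡ f⁺ 𝟎 ⊕ f′ s p
  f⁺-on-S {s} p = begin
    f⁺ s                 ≡⟨ f′-cong (cong (_⊕ s) (sym (⊕-identityʳ a))) ⟩
    f′ ((a ⊕ 𝟎) ⊕ s) _  ≡⟨ f′-additive (a+ℕ^d⊆S 𝟎) p ⟩
    f⁺ 𝟎 ⊕ f′ s p        ∎

  f⁺-injective : Injective _≡_ _≡_ f⁺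
  f⁺-injective eq = ⊕-cancelˡ a _ _ (f′-injective eq)

  f⁺𝟎≤f⁺ : ∀ x j → Vec.lookup (f⁺ 𝟎) j ≤ Vec.lookup (f⁺ x) j
  f⁺𝟎≤f⁺ x = ⊕-progression-nondecreasing (λ k → f⁺ (k · x)) (f⁺ x) (λ k → f⁺-affine (k · x) x)

  φ : ℕ^ d → ℕ^ d
  φ x = zipWith _∸_ (f⁺ x) (f⁺ 𝟎)

  f⁺𝟎⊕φ≡f⁺ : ∀ x → f⁺ 𝟎 ⊕ φ x ≡ f⁺ x
  f⁺𝟎⊕φ≡f⁺ x = a⊕[b∸a]≡b (f⁺ 𝟎) (f⁺ x) (f⁺𝟎≤f⁺ x)

  φ-injective : Injective _≡_ _≡_ φ
  φ-injective {x} {y} φx≡φy = f⁺-injective (begin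
    f⁺ x         ≡⟨ f⁺𝟎⊕φ≡f⁺ x ⟨
    f⁺ 𝟎 ⊕ φ x  ≡⟨ cong (f⁺ 𝟎 ⊕_) φx≡φy ⟩
    f⁺ 𝟎 ⊕ φ y  ≡⟨ f⁺𝟎⊕φ≡f⁺ y ⟩
    f⁺ y         ∎)

  φ-extends-f : ∀ {s} (p : s ∈S S) → φ s ≡ f′ s p
  φ-extends-f {s} p = ⊕-cancelˡ (f⁺ 𝟎) _ _ (trans (f⁺𝟎⊕φ≡f⁺ s) (f⁺-on-S p))

  φ-preserves-holes : ∀ x → ¬ x ∈S S → ¬ φ x ∈S T
  φ-preserves-holes x x∉S φx∈T = x∉S (subst (_∈S S) s≡x p)
    where
    preimage = proj₂ bijective (φ x , φx∈T)
    s = proj₁ (proj₁ preimage)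
    p = proj₂ (proj₁ preimage)

    s≡x : s ≡ x
    s≡x = φ-injective (trans (φ-extends-f p) (cong proj₁ (proj₂ preimage refl)))

genus-≤ : ∀ {d} {S T : Subset (suc d)} {f : Elem S → Elem T} {m n} →
          AddClosed S → IsMonoidIso S T f → HasGenus S m → HasGenus T n → m ≤ n
genus-≤ S-closed iso (H , (H-unique , H-holes) , refl) (K , (_ , K-holes) , refl) =
  injection⇒length≤ φ φ-injective H-unique λ {x} x∈H →
    Equivalence.from (K-holes (φ x)) (φ-preserves-holes x (Equivalence.to (H-holes x) x∈H))
  where open OrthantExtension S-closed iso (proj₂ (holeList⇒orthant (H-unique , H-holes)))

mainTheorem6 : (d : ℕ) → (S T : Subset (suc d)) → IsGNS S → IsGNS T →
               (f : Elem S → Elem T) → IsMonoidIso S T f →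
               (m n : ℕ) → HasGenus S m → HasGenus T n → m ≡ n
mainTheorem6 d S T S-gns T-gns f iso m n S-genus T-genus =
  ≤-antisym (genus-≤ S-closed iso S-genus T-genus)
            (genus-≤ T-closed (proj₂ (inverse-isMonoidIso S-closed iso)) T-genus S-genus)
  where
  S-closed = IsGNS.+-closed S-gns
  T-closed = IsGNS.+-closed T-gns
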